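{- For every finite multiset of formulas $\Gamma$ and formula $\phi$: if $\vdash_{\mathrm{i}\mathsf{K4}_{\mathrm{circ}}}\Gamma\Rightarrow\phi$, then $\vdash_{\mathrm{i}\mathsf{GL}_{\mathrm{fin}}}\Gamma\Rightarrow\phi$.
   Context: Formulas are built from propositional variables and $\bot$ with $\to,\wedge,\vee,\Box$; a sequent $\Gamma\Rightarrow\phi$ is a finite multiset $\Gamma$ of formulas and one formula $\phi$; $\Box\Gamma=\{\Box\psi:\psi\in\Gamma\}$. The rule set $\mathrm{i}\mathsf{G3}$: Prop: $\Gamma,p\Rightarrow p$; Absurd: $\Gamma,\bot\Rightarrow\phi$; $(\wedge L)$: $\Gamma,\phi,\psi\Rightarrow\chi$ / $\Gamma,\phi\wedge\psi\Rightarrow\chi$; $(\wedge R)$: $\Gamma\Rightarrow\phi$, $\Gamma\Rightarrow\psi$ / $\Gamma\Rightarrow\phi\wedge\psi$; $(\vee L)$: $\Gamma,\phi\Rightarrow\chi$, $\Gamma,\psi\Rightarrow\chi$ / $\Gamma,\phi\vee\psi\Rightarrow\chi$; $(\vee R_0)$: $\Gamma\Rightarrow\phi$ / $\Gamma\Rightarrow\phi\vee\psi$; $(\vee R_1)$: $\Gamma\Rightarrow\psi$ / $\Gamma\Rightarrow\phi\vee\psi$; $(\to L)$: $\Gamma,\phi\to\psi\Rightarrow\phi$, $\Gamma,\psi\Rightarrow\chi$ / $\Gamma,\phi\to\psi\Rightarrow\chi$; $(\to R)$: $\Gamma,\phi\Rightarrow\psi$ / $\Gamma\Rightarrow\phi\to\psi$.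 $\mathrm{i}\mathsf{GL}_{\mathrm{Seq}}=\mathrm{i}\mathsf{G3}+\mathrm{R}_{\mathsf{GL}}$ where $\mathrm{R}_{\mathsf{GL}}$: $\Gamma,\Box\Gamma,\Box\phi\Rightarrow\phi$ / $\Pi,\Box\Gamma\Rightarrow\Box\phi$; $\mathrm{i}\mathsf{K4}_{\mathrm{Seq}}=\mathrm{i}\mathsf{G3}+\mathrm{R}_{\mathsf{K4}}$ where $\mathrm{R}_{\mathsf{K4}}$: $\Gamma,\Box\Gamma\Rightarrow\phi$ / $\Pi,\Box\Gamma\Rightarrow\Box\phi$. $\vdash_{\mathrm{i}\mathsf{GL}_{\mathrm{fin}}}S$ means there is a finite proof tree of $S$ in $\mathrm{i}\mathsf{GL}_{\mathrm{Seq}}$ (each node together with its children is a rule instance). A cyclic proof in $\mathrm{i}\mathsf{K4}_{\mathrm{Seq}}$ is a pair $(\kappa,d)$ where $\kappa$ is a finite tree with node labels (sequent, rule name) in which each node is either an instance of a rule of $\mathrm{i}\mathsf{K4}_{\mathrm{Seq}}$ (with its children as premises) or a leaf with rule name "Assump", and $d$ is a total function from Assump-leaves to nodes such that for each Assump-leaf $a$: $d(a)$ is a proper ancestor of $a$, $d(a)$ and $a$ carry the same sequent, and some node on the path from $d(a)$ (inclusive) to $a$ has rule name $\mathrm{R}_{\mathsf{K4}}$. $\vdash_{\mathrm{i}\mathsf{K4}_{\mathrm{circ}}}S$ means there is a cyclic proof whose root sequent is $S$. -}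

module Defs where

open import Data.Nat using (ℕ)
open import Data.Bool using (Bool; true; false; _∨_)
open import Data.List using (List; []; _∷_; _++_; map; [_])
open import Data.List.Relation.Unary.All using (All)
open import Data.List.Relation.Unary.Any using (Any)
open import Data.List.Relation.Binary.Pointwise using (Pointwise)
open import Data.List.Relation.Binary.Permutation.Propositional using (_↭_)
open import Data.Product using (_×_; _,_; Σ; proj₁; proj₂)
open import Relation.Binary.PropositionalEquality using (_≡_)

infixr 5 _⊃_
infixr 6 _∨'_
infixr 7 _∧'_

data Form : Set where
  var  : ℕ → Form
  ⊥'   : Form
  _⊃_  : Form → Form → Form
  _∧'_ : Form → Form → Form
  _∨'_ : Form → Form → Form
  □    : Form → Form

□s : List Form → List Form
□s = map □

-- Sequents Γ ⇒ φ: Γ a finite multiset, represented by a list and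
-- compared up to permutation.

Sequent : Set
Sequent = List Form × Form

_≈ₛ_ : Sequent → Sequent → Set
(Γ , φ) ≈ₛ (Δ , ψ) = (Γ ↭ Δ) × (φ ≡ ψ)

data RuleName : Set where
  Prop Absurd ∧L ∧R ∨L ∨R₀ ∨R₁ ⊃L ⊃R RK4 RGL : RuleName

data Base : RuleName → List Sequent → Sequent → Set where
  prop   : ∀ {Γ p} → Base Prop [] (var p ∷ Γ , var p)
  absurd : ∀ {Γ φ} → Base Absurd [] (⊥' ∷ Γ , φ)
  ∧l     : ∀ {Γ φ ψ χ} →
           Base ∧L [ (φ ∷ ψ ∷ Γ , χ) ] ((φ ∧' ψ) ∷ Γ , χ)
  ∧r     : ∀ {Γ φ ψ} →
           Base ∧R ((Γ , φ) ∷ (Γ , ψ) ∷ []) (Γ , φ ∧' ψ)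
  ∨l     : ∀ {Γ φ ψ χ} →
           Base ∨L ((φ ∷ Γ , χ) ∷ (ψ ∷ Γ , χ) ∷ []) ((φ ∨' ψ) ∷ Γ , χ)
  ∨r₀    : ∀ {Γ φ ψ} → Base ∨R₀ [ (Γ , φ) ] (Γ , φ ∨' ψ)
  ∨r₁    : ∀ {Γ φ ψ} → Base ∨R₁ [ (Γ , ψ) ] (Γ , φ ∨' ψ)
  ⊃l     : ∀ {Γ φ ψ χ} →
           Base ⊃L (((φ ⊃ ψ) ∷ Γ , φ) ∷ (ψ ∷ Γ , χ) ∷ []) ((φ ⊃ ψ) ∷ Γ , χ)
  ⊃r     : ∀ {Γ φ ψ} → Base ⊃R [ (φ ∷ Γ , ψ) ] (Γ , φ ⊃ ψ)
  rk4    : ∀ {Γ Π φ} →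
           Base RK4 [ (Γ ++ □s Γ , φ) ] (Π ++ □s Γ , □ φ)
  rgl    : ∀ {Γ Π φ} →
           Base RGL [ (Γ ++ □s Γ ++ [ □ φ ] , φ) ] (Π ++ □s Γ , □ φ)

Inst : RuleName → List Sequent → Sequent → Set
Inst r ps s = Σ (List Sequent) λ ps₀ → Σ Sequent λ s₀ →
  Base r ps₀ s₀ × Pointwise _≈ₛ_ ps ps₀ × (s ≈ₛ s₀)

data InG3 : RuleName → Set where
  prop : InG3 Prop
  absurd : InG3 Absurd
  ∧l : InG3 ∧L
  ∧r : InG3 ∧R
  ∨l : InG3 ∨L
  ∨r₀ : InG3 ∨R₀
  ∨r₁ : InG3 ∨R₁
  ⊃l : InG3 ⊃L
  ⊃r : InG3 ⊃R

data InGL : RuleName → Set where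
  g3  : ∀ {r} → InG3 r → InGL r
  rgl : InGL RGL

data InK4 : RuleName → Set where
  g3  : ∀ {r} → InG3 r → InK4 r
  rk4 : InK4 RK4

data GLProof : Sequent → Set where
  by : ∀ {r ps s} → InGL r → Inst r ps s → All GLProof ps → GLProof s

⊢iGLfin : Sequent → Set
⊢iGLfin = GLProof

-- A finite tree is built inductively; the index H lists the ancestors of
-- the current node (nearest first), each with its sequent and a flag that
-- is true iff some node on the path from that ancestor (inclusive) down to
-- the current node (exclusive) is an R_K4 node.  An Assump leaf must point
-- (this pointer is d) to a proper ancestor carrying the same sequent whose
-- flag is true (the leaf itself is not an R_K4 node).

isRK4 : RuleName → Bool
isRK4 RK4 = true
isRK4 _   = false

History : Set
History = List (Sequent × Bool)

push : RuleName → Sequent → History → History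
push r s H = (s , isRK4 r) ∷ map (λ e → proj₁ e , (proj₂ e ∨ isRK4 r)) H

data CycTree : History → Sequent → Set where
  rule   : ∀ {H r ps s} → InK4 r → Inst r ps s →
           All (CycTree (push r s H)) ps → CycTree H s
  assump : ∀ {H s} →
           Any (λ e → (proj₁ e ≈ₛ s) × (proj₂ e ≡ true)) H → CycTree H s

⊢iK4circ : Sequent → Set
⊢iK4circ S = CycTree [] S

-- A cyclic iK4 proof is unfolded into a finite iGL proof by carrying along a
-- list E of formulas whose boxes have already been assumed. Every R_K4 node
-- with conclusion □φ becomes an R_GL step that adds φ to E, unless □φ is
-- already in □E, in which case the node is closed by an identity axiom. The
-- number of succedents of the cyclic proof that are not yet in □E therefore
-- strictly decreases along every cycle, and an Assump leaf is closed by the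
-- (well-founded) recursive call on its companion with the larger E.
module Submission where

open import Defs
open import Data.Bool using (Bool; true; false; _∨_)
open import Data.Empty using (⊥-elim)
open import Data.List using (List; []; _∷_; _++_; map; [_])
open import Data.List.Properties using (map-++; ++-identityʳ)
open import Data.List.Membership.Propositional using (_∈_; _∉_)
open import Data.List.Membership.Propositional.Properties using (∈-∃++; ∈-++⁺ˡ; ∈-++⁺ʳ)
open import Data.List.Relation.Binary.Subset.Propositional using (_⊆_)
open import Data.List.Relation.Binary.Subset.Propositional.Properties
  using (⊆-refl; ⊆-trans; xs⊆x∷xs)
  renaming (map⁺ to ⊆-map⁺)
open import Data.List.Relation.Unary.All as All using (All; []; _∷_; lookupAny)
open import Data.List.Relation.Unary.All.Properties using () renaming (map⁺ to All-map⁺)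
open import Data.List.Relation.Unary.Any using (here; there)
open import Data.List.Relation.Binary.Pointwise as Pointwise using ([]; _∷_)
open import Data.List.Relation.Binary.Permutation.Propositional
  using (_↭_; ↭-refl; ↭-sym; ↭-trans; ↭-swap; ↭-reflexive; module PermutationReasoning)
open import Data.List.Relation.Binary.Permutation.Propositional.Properties
  using (++⁺ʳ; shift; ++-comm; ++-commutativeMonoid)
open import Data.Nat using (ℕ; suc; _≤_; _<_; s≤s; z≤n)
import Data.Nat.Properties as ℕ
open import Data.Nat.Induction using (<-wellFounded)
open import Data.Product using (_×_; _,_; proj₁; proj₂; uncurry)
open import Function using (_∘_; _$_)
open import Induction.WellFounded using (Acc; acc)
open import Relation.Binary.Definitions using (DecidableEquality)
open import Relation.Binary.PropositionalEquality using (_≡_; _≢_; refl; sym; trans; cong; cong₂)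
open import Relation.Nullary using (Dec; yes; no)
open import Relation.Nullary.Decidable using (map′; _×-dec_)
open import Algebra.Solver.CommutativeMonoid (++-commutativeMonoid {A = Form})
  using (solve; _⊜_; _⊕_)

module CountMissing {A : Set} (_≟_ : DecidableEquality A) where

  open import Data.List.Membership.DecPropositional _≟_ using (_∈?_)

  countMissing : List A → List A → ℕ
  countMissing [] B = 0
  countMissing (x ∷ L) B with x ∈? B
  ... | yes _ = countMissing L B
  ... | no _  = suc (countMissing L B)

  countMissing-antitone : ∀ L {B B'} → B ⊆ B' → countMissing L B' ≤ countMissing L B
  countMissing-antitone [] B⊆B' = z≤n
  countMissing-antitone (x ∷ L) {B} {B'} B⊆B' with x ∈? B | x ∈? B'
  ... | yes x∈B | no x∉B' = ⊥-elim (x∉B' (B⊆B' x∈B))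
  ... | yes _   | yes _   = countMissing-antitone L B⊆B'
  ... | no _    | yes _   = ℕ.m≤n⇒m≤1+n (countMissing-antitone L B⊆B')
  ... | no _    | no _    = s≤s (countMissing-antitone L B⊆B')

  countMissing-strict : ∀ L {B B' y} → B ⊆ B' → y ∈ L → y ∉ B → y ∈ B' →
                        countMissing L B' < countMissing L B
  countMissing-strict (x ∷ L) {B} {B'} B⊆B' (here refl) y∉B y∈B'
    with x ∈? B | x ∈? B'
  ... | yes x∈B | _       = ⊥-elim (y∉B x∈B)
  ... | no _    | no x∉B' = ⊥-elim (x∉B' y∈B')
  ... | no _    | yes _   = s≤s (countMissing-antitone L B⊆B')
  countMissing-strict (x ∷ L) {B} {B'} B⊆B' (there y∈L) y∉B y∈B'
    with x ∈? B | x ∈? B'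
  ... | yes x∈B | no x∉B' = ⊥-elim (x∉B' (B⊆B' x∈B))
  ... | yes _   | yes _   = countMissing-strict L B⊆B' y∈L y∉B y∈B'
  ... | no _    | yes _   = ℕ.m≤n⇒m≤1+n (countMissing-strict L B⊆B' y∈L y∉B y∈B')
  ... | no _    | no _    = s≤s (countMissing-strict L B⊆B' y∈L y∉B y∈B')

tag : Form → ℕ
tag (var _)  = 0
tag ⊥'       = 1
tag (_ ⊃ _)  = 2
tag (_ ∧' _) = 3
tag (_ ∨' _) = 4
tag (□ _)    = 5

-- Comparing tags first leaves only the diagonal cases: for the others the
-- tag equality refl is refuted by unification.
mutual
  _≟_ : DecidableEquality Form
  φ ≟ ψ = ≟-sameTag φ ψ (tag φ ℕ.≟ tag ψ)

  ≟-sameTag : ∀ φ ψ → Dec (tag φ ≡ tag ψ) → Dec (φ ≡ ψ)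
  ≟-sameTag φ ψ (no ≢tag) = no (≢tag ∘ cong tag)
  ≟-sameTag (var m) (var n) (yes refl) = map′ (cong var) (λ { refl → refl }) (m ℕ.≟ n)
  ≟-sameTag ⊥' ⊥' (yes refl) = yes refl
  ≟-sameTag (a ⊃ b) (c ⊃ d) (yes refl) =
    map′ (uncurry (cong₂ _⊃_)) (λ { refl → refl , refl }) (a ≟ c ×-dec b ≟ d)
  ≟-sameTag (a ∧' b) (c ∧' d) (yes refl) =
    map′ (uncurry (cong₂ _∧'_)) (λ { refl → refl , refl }) (a ≟ c ×-dec b ≟ d)
  ≟-sameTag (a ∨' b) (c ∨' d) (yes refl) =
    map′ (uncurry (cong₂ _∨'_)) (λ { refl → refl , refl }) (a ≟ c ×-dec b ≟ d)
  ≟-sameTag (□ a) (□ b) (yes refl) = map′ (cong □) (λ { refl → refl }) (a ≟ b)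

open import Data.List.Membership.DecPropositional _≟_ using (_∈?_)
open CountMissing _≟_

≈ₛ-refl : ∀ {s} → s ≈ₛ s
≈ₛ-refl = ↭-refl , refl

≈ₛ-sym : ∀ {s t} → s ≈ₛ t → t ≈ₛ s
≈ₛ-sym (Γ↭Δ , φ≡ψ) = ↭-sym Γ↭Δ , sym φ≡ψ

≈ₛ-trans : ∀ {s t u} → s ≈ₛ t → t ≈ₛ u → s ≈ₛ u
≈ₛ-trans (Γ↭Δ , φ≡ψ) (Δ↭Θ , ψ≡χ) = ↭-trans Γ↭Δ Δ↭Θ , trans φ≡ψ ψ≡χ

_++ₛ_ : Sequent → List Form → Sequent
(Γ , φ) ++ₛ X = (Γ ++ X , φ)

≈ₛ-++ₛ : ∀ {s t} X → s ≈ₛ t → (s ++ₛ X) ≈ₛ (t ++ₛ X)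
≈ₛ-++ₛ X (Γ↭Δ , φ≡ψ) = ++⁺ʳ X Γ↭Δ , φ≡ψ

Inst-++ₛ : ∀ {r ps s} X → InG3 r → Inst r ps s → Inst r (map (_++ₛ X) ps) (s ++ₛ X)
Inst-++ₛ X r∈G3 (ps₀ , s₀ , base , ps≈ , s≈) =
  map (_++ₛ X) ps₀ , s₀ ++ₛ X , Base-++ₛ r∈G3 base ,
  Pointwise.map⁺ _ _ (Pointwise.map (≈ₛ-++ₛ X) ps≈) , ≈ₛ-++ₛ X s≈
  where
  Base-++ₛ : ∀ {r ps s} → InG3 r → Base r ps s → Base r (map (_++ₛ X) ps) (s ++ₛ X)
  Base-++ₛ prop   prop   = prop
  Base-++ₛ absurd absurd = absurd
  Base-++ₛ ∧l     ∧l     = ∧l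
  Base-++ₛ ∧r     ∧r     = ∧r
  Base-++ₛ ∨l     ∨l     = ∨l
  Base-++ₛ ∨r₀    ∨r₀    = ∨r₀
  Base-++ₛ ∨r₁    ∨r₁    = ∨r₁
  Base-++ₛ ⊃l     ⊃l     = ⊃l
  Base-++ₛ ⊃r     ⊃r     = ⊃r

GLProof-resp : ∀ {s t} → s ≈ₛ t → GLProof s → GLProof t
GLProof-resp s≈t (by r (ps₀ , s₀ , base , ps≈ , s≈s₀) premises) =
  by r (ps₀ , s₀ , base , ps≈ , ≈ₛ-trans (≈ₛ-sym s≈t) s≈s₀) premises

GLProof-perm : ∀ {Γ Δ φ} → Γ ↭ Δ → GLProof (Γ , φ) → GLProof (Δ , φ)
GLProof-perm Γ↭Δ = GLProof-resp (Γ↭Δ , refl)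

by-Base : ∀ {r ps s} → InGL r → Base r ps s → All GLProof ps → GLProof s
by-Base r base = by r (_ , _ , base , Pointwise.refl ≈ₛ-refl , ≈ₛ-refl)

identity : ∀ φ Γ → GLProof (φ ∷ Γ , φ)
identity (var p) Γ = by-Base (g3 prop) prop []
identity ⊥' Γ = by-Base (g3 absurd) absurd []
identity (φ ⊃ ψ) Γ =
  by-Base (g3 ⊃r) ⊃r
    (GLProof-perm (↭-swap _ _ ↭-refl)
      (by-Base (g3 ⊃l) ⊃l
        (GLProof-perm (↭-swap _ _ ↭-refl) (identity φ ((φ ⊃ ψ) ∷ Γ)) ∷
         identity ψ (φ ∷ Γ) ∷ []))
    ∷ [])
identity (φ ∧' ψ) Γ =
  by-Base (g3 ∧r) ∧r
    (by-Base (g3 ∧l) ∧l (identity φ (ψ ∷ Γ) ∷ []) ∷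
     by-Base (g3 ∧l) ∧l (GLProof-perm (↭-swap _ _ ↭-refl) (identity ψ (φ ∷ Γ)) ∷ []) ∷ [])
identity (φ ∨' ψ) Γ =
  by-Base (g3 ∨l) ∨l
    (by-Base (g3 ∨r₀) ∨r₀ (identity φ Γ ∷ []) ∷
     by-Base (g3 ∨r₁) ∨r₁ (identity ψ Γ ∷ []) ∷ [])
identity (□ φ) Γ =
  GLProof-perm (++-comm Γ [ □ φ ]) (by-Base rgl (rgl {Γ = [ φ ]} {Π = Γ}) (identity φ _ ∷ []))

identity-∈ : ∀ {φ Γ} → φ ∈ Γ → GLProof (Γ , φ)
identity-∈ {φ} φ∈Γ with ∈-∃++ φ∈Γ
... | Δ , Θ , refl = GLProof-perm (↭-sym (shift φ Δ Θ)) (identity φ (Δ ++ Θ))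

rgl-from-rk4-premise : ∀ {Δ ψ Γ Π W E φ} → (Δ , ψ) ≈ₛ (Γ ++ □s Γ , φ) →
                       GLProof (Δ ++ E ++ □s (φ ∷ E) , ψ) →
                       GLProof ((Π ++ □s Γ) ++ W ++ □s E , □ φ)
rgl-from-rk4-premise {Δ} {Γ = Γ} {Π} {W} {E} {φ} (Δ↭ , refl) premise =
  GLProof-perm (↭-sym conclusion↭)
    (by-Base rgl (rgl {Γ = Γ ++ E} {Π = Π ++ W}) (GLProof-perm premise↭ premise ∷ []))
  where
  open PermutationReasoning
  premise↭ : Δ ++ E ++ □ φ ∷ □s E ↭ (Γ ++ E) ++ □s (Γ ++ E) ++ [ □ φ ]
  premise↭ = begin
    Δ ++ E ++ □ φ ∷ □s E                   ↭⟨ ++⁺ʳ _ Δ↭ ⟩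
    (Γ ++ □s Γ) ++ E ++ [ □ φ ] ++ □s E
      ↭⟨ solve 5 (λ γ □γ ε □φ □ε → (γ ⊕ □γ) ⊕ ε ⊕ □φ ⊕ □ε ⊜ (γ ⊕ ε) ⊕ (□γ ⊕ □ε) ⊕ □φ)
               ↭-refl Γ (□s Γ) E [ □ φ ] (□s E) ⟩
    (Γ ++ E) ++ (□s Γ ++ □s E) ++ [ □ φ ]
      ≡⟨ cong (λ □ΓE → (Γ ++ E) ++ □ΓE ++ [ □ φ ]) (map-++ □ Γ E) ⟨
    (Γ ++ E) ++ □s (Γ ++ E) ++ [ □ φ ]     ∎
  conclusion↭ : (Π ++ □s Γ) ++ W ++ □s E ↭ (Π ++ W) ++ □s (Γ ++ E)
  conclusion↭ = begin
    (Π ++ □s Γ) ++ W ++ □s E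
      ↭⟨ solve 4 (λ π □γ w □ε → (π ⊕ □γ) ⊕ w ⊕ □ε ⊜ (π ⊕ w) ⊕ □γ ⊕ □ε)
               ↭-refl Π (□s Γ) W (□s E) ⟩
    (Π ++ W) ++ □s Γ ++ □s E   ≡⟨ cong ((Π ++ W) ++_) (map-++ □ Γ E) ⟨
    (Π ++ W) ++ □s (Γ ++ E)    ∎

mutual
  succedents : ∀ {H s} → CycTree H s → List Form
  succedents {s = s} (rule _ _ ts) = proj₂ s ∷ succedentsAll ts
  succedents (assump _) = []

  succedentsAll : ∀ {H ps} → All (CycTree H) ps → List Form
  succedentsAll [] = []
  succedentsAll (t ∷ ts) = succedents t ++ succedentsAll ts

InG3⇒¬RK4 : ∀ {r} → InG3 r → isRK4 r ≢ true
InG3⇒¬RK4 prop   ()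
InG3⇒¬RK4 absurd ()
InG3⇒¬RK4 ∧l     ()
InG3⇒¬RK4 ∧r     ()
InG3⇒¬RK4 ∨l     ()
InG3⇒¬RK4 ∨r₀    ()
InG3⇒¬RK4 ∨r₁    ()
InG3⇒¬RK4 ⊃l     ()
InG3⇒¬RK4 ⊃r     ()

module Translation (D : List Form) where

  μ : List Form → ℕ
  μ E = countMissing D (□s E)

  μ-antitone : ∀ {E E'} → E ⊆ E' → μ E' ≤ μ E
  μ-antitone E⊆E' = countMissing-antitone D (⊆-map⁺ □ E⊆E')

  μ-insert : ∀ {φ E} → □ φ ∈ D → □ φ ∉ □s E → μ (φ ∷ E) < μ E
  μ-insert □φ∈D □φ∉□E = countMissing-strict D (xs⊆x∷xs _ _) □φ∈D □φ∉□E (here refl)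

  Derivable : List Form → Sequent → Set
  Derivable E s = ∀ W → GLProof (s ++ₛ (W ++ □s E))

  DerivableBeyond : List Form → Sequent → Set
  DerivableBeyond E s = ∀ {E'} → E ⊆ E' → μ E' < μ E → Derivable E' s

  -- Invariant for an ancestor (s , b) of a node translated with E: s was
  -- translated with `boxes`, and μ has dropped since if an R_K4 node lies
  -- in between (b ≡ true).
  record Entry (E : List Form) (e : Sequent × Bool) : Set where
    field
      boxes      : List Form
      boxes⊆     : boxes ⊆ E
      decreased  : proj₂ e ≡ true → μ E < μ boxes
      derivable  : DerivableBeyond boxes (proj₁ e)

  Env : History → List Form → Set
  Env H E = All (Entry E) H

  entry-mono : ∀ {E E' e} → E ⊆ E' → Entry E e → Entry E' e
  entry-mono E⊆E' en = record
    { boxes     = boxes en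
    ; boxes⊆    = ⊆-trans (boxes⊆ en) E⊆E'
    ; decreased = ℕ.≤-<-trans (μ-antitone E⊆E') ∘ decreased en
    ; derivable = derivable en
    }
    where open Entry

  entry-push : ∀ {E E' s b k} → (k ≡ true → μ E' < μ E) → E ⊆ E' →
               Entry E (s , b) → Entry E' (s , b ∨ k)
  entry-push {b = true}  _    E⊆E' en = entry-mono E⊆E' en
  entry-push {b = false} drop E⊆E' en = record
    { boxes     = boxes en
    ; boxes⊆    = ⊆-trans (boxes⊆ en) E⊆E'
    ; decreased = λ k≡true → ℕ.<-≤-trans (drop k≡true) (μ-antitone (boxes⊆ en))
    ; derivable = derivable en
    }
    where open Entry

  env-push : ∀ {H r s E E'} → (isRK4 r ≡ true → μ E' < μ E) → E ⊆ E' →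
             DerivableBeyond E s → Env H E → Env (push r s H) E'
  env-push drop E⊆E' self env =
    record { boxes = _ ; boxes⊆ = E⊆E' ; decreased = drop ; derivable = self } ∷
    All-map⁺ (All.map (entry-push drop E⊆E') env)

  mutual
    translate : ∀ {H s E} → Acc _<_ (μ E) → (T : CycTree H s) → succedents T ⊆ D →
                Env H E → Derivable E s
    translate {H} {s} {E} a T@(rule (g3 r∈G3) inst ts) T⊆D env W =
      by (g3 r∈G3) (Inst-++ₛ (W ++ □s E) r∈G3 inst)
        (All-map⁺ (All.map (_$ W) (translateAll a ts (T⊆D ∘ there) env′)))
      where
      env′ : Env (push _ s H) E
      env′ = env-push (⊥-elim ∘ InG3⇒¬RK4 r∈G3) ⊆-refl (beyond a T T⊆D env) env
    -- `beyond` is applied before the `with` so that the termination checker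
    -- sees it called on the unchanged accessibility proof.
    translate {H} {Δ , _} {E} a@(acc rs)
      T@(rule rk4 (_ , _ , rk4 {Γ} {Π} {φ} , premise≈ ∷ [] , (Δ↭ , refl)) (t ∷ [])) T⊆D env W
      with □ φ ∈? □s E | beyond a T T⊆D env
    ... | yes □φ∈□E | _ = identity-∈ (∈-++⁺ʳ Δ (∈-++⁺ʳ W □φ∈□E))
    ... | no □φ∉□E | self =
      GLProof-perm (↭-sym (++⁺ʳ (W ++ □s E) Δ↭))
        (rgl-from-rk4-premise {Γ = Γ} {Π} premise≈
          (translate (rs μ↓) t (T⊆D ∘ there ∘ ∈-++⁺ˡ) env′ E))
      where
      μ↓ : μ (φ ∷ E) < μ E
      μ↓ = μ-insert (T⊆D (here refl)) □φ∉□E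
      env′ : Env (push RK4 (Δ , □ φ) H) (φ ∷ E)
      env′ = env-push (λ _ → μ↓) (xs⊆x∷xs E φ) self env
    translate a (assump loop) T⊆D env W with lookupAny env loop
    ... | en , s≈ , marked =
      GLProof-resp (≈ₛ-++ₛ _ s≈) (derivable en (boxes⊆ en) (decreased en marked) W)
      where open Entry

    beyond : ∀ {H s E} → Acc _<_ (μ E) → (T : CycTree H s) → succedents T ⊆ D →
             Env H E → DerivableBeyond E s
    beyond (acc rs) T T⊆D env E⊆E' μ↓ =
      translate (rs μ↓) T T⊆D (All.map (entry-mono E⊆E') env)

    translateAll : ∀ {H ps E} → Acc _<_ (μ E) → (ts : All (CycTree H) ps) →
                   succedentsAll ts ⊆ D → Env H E → All (Derivable E) ps
    translateAll a [] _ env = []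
    translateAll a (t ∷ ts) ts⊆D env =
      translate a t (ts⊆D ∘ ∈-++⁺ˡ) env ∷ translateAll a ts (ts⊆D ∘ ∈-++⁺ʳ _) env

mainTheorem7 : (Γ : List Form) (φ : Form) → ⊢iK4circ (Γ , φ) → ⊢iGLfin (Γ , φ)
mainTheorem7 Γ φ T =
  GLProof-perm (↭-reflexive (++-identityʳ Γ))
    (translate (<-wellFounded _) T ⊆-refl [] [])
  where open Translation (succedents T)
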